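{- Let $T$ be a rooted tree with at most $\Delta$ vertices in which every vertex has at most two children, and run tree-decompose$(T)$. Then the resulting decomposition tree has $O(\log\Delta)$ levels, and every piece in the decomposition tree has at most $3$ portals.
   Context: A piece of $T$ is a connected subgraph $T'$ of $T$ (itself a rooted tree) such that for every vertex $v$ of $T'$, either all children of $v$ in $T$ belong to $T'$ or none does. A portal of a piece $T'$ is a vertex that is a leaf of $T'$ but not of $T$. For a vertex $v$ of $T'$, $T'[v]$ is the subtree of $T'$ rooted at $v$. The recursive procedure tree-decompose$(T')$ on a piece $T'$: (1) if $T'$ is a single vertex, return; (2) if $T'$ has exactly one level of edges, call tree-decompose on each leaf of $T'$ as a singleton and return; (3) otherwise let $D$ be the set of portals of $T'$; if $|D|\le 2$, choose a non-root non-leaf vertex $v$ of $T'$ such that $T'[v]$ has size in $[\lfloor |V(T')|/3\rfloor,\lceil 2|V(T')|/3\rceil]$; otherwise choose a vertex $v$ of $T'$ with $|V(T'[v])\cap D|=2$; then call tree-decompose on $T'$ with all proper descendants of $v$ removed (keeping $v$), and on $T'[v]$. The decomposition tree has the pieces on which tree-decompose is called as nodes, where $T''$ is a child of $T'$ if tree-decompose$(T')$ directly calls tree-decompose$(T'')$. -}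

module Defs where

open import Data.Nat using (ℕ; zero; suc; _+_; _*_; _≤_; _⊔_)
open import Data.Nat.DivMod using (_/_)
open import Data.List using (List; []; _∷_; length)
open import Data.Product using (Σ; _,_; _×_)
open import Data.Empty using (⊥)
open import Data.Sum using (_⊎_)
open import Relation.Nullary using (¬_)
open import Data.Unit using (⊤)
open import Relation.Binary.PropositionalEquality using (_≡_)

data Tree : Set where
  node : List Tree → Tree

mutual
  treeSize : Tree → ℕ
  treeSize (node ts) = suc (forestSize ts)

  forestSize : List Tree → ℕ
  forestSize [] = 0
  forestSize (t ∷ ts) = treeSize t + forestSize ts

mutual
  data Binary : Tree → Set where
    bin : ∀ {ts} → length ts ≤ 2 → BinaryF ts → Binary (node ts)

  data BinaryF : List Tree → Set where
    []  : BinaryF []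
    _∷_ : ∀ {t ts} → Binary t → BinaryF ts → BinaryF (t ∷ ts)

-- A piece of T whose root is the vertex v of T is described
-- relative to the subtree t = T[v]: at every vertex we either stop
-- (none of its children is in the piece, i.e. it is a leaf of the piece)
-- or grow (all of its children are in the piece).  To make the
-- representation unique, 'grow' is only allowed at vertices having at
-- least one child in T.

mutual
  data Piece : Tree → Set where
    stop : ∀ {ts} → Piece (node ts)
    grow : ∀ {t ts} → Pieces (t ∷ ts) → Piece (node (t ∷ ts))

  data Pieces : List Tree → Set where
    []  : Pieces []
    _∷_ : ∀ {t ts} → Piece t → Pieces ts → Pieces (t ∷ ts)

mutual
  size : ∀ {t} → Piece t → ℕ
  size stop = 1
  size (grow ps) = suc (sizes ps)

  sizes : ∀ {ts} → Pieces ts → ℕ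
  sizes [] = 0
  sizes (p ∷ ps) = size p + sizes ps

mutual
  portals : ∀ {t} → Piece t → ℕ
  portals (stop {[]}) = 0
  portals (stop {_ ∷ _}) = 1
  portals (grow ps) = portalsS ps

  portalsS : ∀ {ts} → Pieces ts → ℕ
  portalsS [] = 0
  portalsS (p ∷ ps) = portals p + portalsS ps

mutual
  whole : (t : Tree) → Piece t
  whole (node []) = stop
  whole (node (t ∷ ts)) = grow (wholeS (t ∷ ts))

  wholeS : (ts : List Tree) → Pieces ts
  wholeS [] = []
  wholeS (t ∷ ts) = whole t ∷ wholeS ts

AllStop : ∀ {ts} → Pieces ts → Set
AllStop [] = ⊤
AllStop (stop ∷ ps) = AllStop ps
AllStop (grow _ ∷ _) = ⊥

mutual
  data Pos : ∀ {t} → Piece t → Set where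
    here  : ∀ {t} {p : Piece t} → Pos p
    there : ∀ {t ts} {ps : Pieces (t ∷ ts)} → PosS ps → Pos (grow ps)

  data PosS : ∀ {ts} → Pieces ts → Set where
    hd : ∀ {t ts} {p : Piece t} {ps : Pieces ts} → Pos p → PosS (p ∷ ps)
    tl : ∀ {t ts} {p : Piece t} {ps : Pieces ts} → PosS ps → PosS (p ∷ ps)

mutual
  subTree : ∀ {t} (p : Piece t) → Pos p → Tree
  subTree {t} p here = t
  subTree (grow ps) (there i) = subTreeS ps i

  subTreeS : ∀ {ts} (ps : Pieces ts) → PosS ps → Tree
  subTreeS (p ∷ ps) (hd i) = subTree p i
  subTreeS (p ∷ ps) (tl i) = subTreeS ps i

mutual
  subPiece : ∀ {t} (p : Piece t) (v : Pos p) → Piece (subTree p v)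
  subPiece p here = p
  subPiece (grow ps) (there i) = subPieceS ps i

  subPieceS : ∀ {ts} (ps : Pieces ts) (v : PosS ps) → Piece (subTreeS ps v)
  subPieceS (p ∷ ps) (hd i) = subPiece p i
  subPieceS (p ∷ ps) (tl i) = subPieceS ps i

mutual
  cutAt : ∀ {t} (p : Piece t) → Pos p → Piece t
  cutAt p here = stop'
    where
      stop' : ∀ {t} → Piece t
      stop' {node _} = stop
  cutAt (grow ps) (there i) = grow (cutAtS ps i)

  cutAtS : ∀ {ts} (ps : Pieces ts) → PosS ps → Pieces ts
  cutAtS (p ∷ ps) (hd i) = cutAt p i ∷ ps
  cutAtS (p ∷ ps) (tl i) = p ∷ cutAtS ps i

IsRoot : ∀ {t} {p : Piece t} → Pos p → Set
IsRoot here = ⊤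
IsRoot (there _) = ⊥

NonLeafPiece : ∀ {t} → Piece t → Set
NonLeafPiece stop = ⊥
NonLeafPiece (grow _) = ⊤

-- |V(T'[v])| ∈ [⌊n/3⌋, ⌈2n/3⌉] where n = |V(T')|;  ⌈2n/3⌉ = ⌊(2n+2)/3⌋
Balanced : ℕ → ℕ → Set
Balanced n m = (n / 3 ≤ m) × (m ≤ (2 * n + 2) / 3)

ValidChoice : ∀ {t} (p : Piece t) → Pos p → Set
ValidChoice p v =
    (portals p ≤ 2 × ¬ IsRoot v × NonLeafPiece (subPiece p v)
       × Balanced (size p) (size (subPiece p v)))
  ⊎ (3 ≤ portals p × portals (subPiece p v) ≡ 2)

data DTree : Set where
  dnode : (t : Tree) → Piece t → List DTree → DTree

mutual
  levels : DTree → ℕ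
  levels (dnode _ _ ds) = suc (levelsL ds)

  levelsL : List DTree → ℕ
  levelsL [] = 0
  levelsL (d ∷ ds) = levels d ⊔ levelsL ds

leafNodes : ∀ {ts} → Pieces ts → List DTree
leafNodes [] = []
leafNodes (_∷_ {node us} _ ps) = dnode (node us) stop [] ∷ leafNodes ps

data Run : ∀ {t} → Piece t → DTree → Set where
  single   : ∀ {ts} → Run (stop {ts}) (dnode (node ts) stop [])
  oneLevel : ∀ {t ts} (ps : Pieces (t ∷ ts)) → AllStop ps →
             Run (grow ps) (dnode (node (t ∷ ts)) (grow ps) (leafNodes ps))
  split    : ∀ {t ts} (ps : Pieces (t ∷ ts)) → ¬ AllStop ps →
             (v : Pos (grow ps)) → ValidChoice (grow ps) v →
             ∀ {d₁ d₂} → Run (cutAt (grow ps) v) d₁ → Run (subPiece (grow ps) v) d₂ →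
             Run (grow ps) (dnode (node (t ∷ ts)) (grow ps) (d₁ ∷ d₂ ∷ []))

mutual
  AllPieces : (∀ {t} → Piece t → Set) → DTree → Set
  AllPieces P (dnode _ p ds) = P p × AllPiecesL P ds

  AllPiecesL : (∀ {t} → Piece t → Set) → List DTree → Set
  AllPiecesL P [] = ⊤
  AllPiecesL P (d ∷ ds) = AllPieces P d × AllPiecesL P ds

-- Every split performed by tree-decompose cuts a piece at a vertex v into
-- T'[v] and T' minus the descendants of v; the two parts share only v, and
-- v is a portal of the upper part exactly when it is a non-leaf of T.  Hence
-- portals are nearly additive: p(upper) + p(lower) ≤ p(T') + 1.  A piece
-- with at most 2 portals is split in a balanced way, and both parts have at
-- most 3 portals; a piece with 3 portals is split at a vertex whose subtree
-- holds 2 of them, and both parts have at most 2 portals.  So portals never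
-- exceed 3, and along any root-to-leaf path of the decomposition tree every
-- other split is balanced.  A balanced split reduces the potential
-- φ n = ⌊log₂ n²⌋ + min(n, 42) of the size n, which gives at most
-- 2 φ(Δ) + 3 = O(log Δ) levels.

module Submission where

open import Defs
open import Data.Nat using (ℕ; suc; _+_; _*_; _^_; _≤_; _<_; _⊓_; _∸_; z≤n; s≤s; _≤?_; _<?_)
open import Data.Nat.Properties
open import Data.Nat.DivMod using (_/_; _%_; m≡m%n+[m/n]*n; m%n<n; m/n*n≤m)
open import Data.Nat.Logarithm using (⌊log₂_⌋; ⌊log₂⌋-mono-≤; ⌊log₂[2*b]⌋≡1+⌊log₂b⌋; ⌊log₂[2^n]⌋≡n)
open import Data.Nat.Solver using (module +-*-Solver)
open import Algebra.Properties.CommutativeSemigroup +-commutativeSemigroup using (xy∙z≈xz∙y; x∙yz≈y∙xz)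
open import Data.Product using (Σ; _×_; _,_; proj₁; proj₂)
open import Data.Sum using (inj₁; inj₂)
open import Data.List using ([]; _∷_)
open import Data.Unit using (tt)
open import Data.Empty using (⊥-elim)
open import Relation.Nullary using (¬_; yes; no)
open import Relation.Binary.PropositionalEquality using (_≡_; refl; sym; trans; cong; cong₂)

open +-*-Solver using (solve; _:+_; _:*_; _:=_; con)

stopAt : (t : Tree) → Piece t
stopAt (node _) = stop

portals-stopAt≤1 : ∀ t → portals (stopAt t) ≤ 1
portals-stopAt≤1 (node [])      = z≤n
portals-stopAt≤1 (node (_ ∷ _)) = s≤s z≤n

private
  split-in-head : ∀ {a b c} e → a + c ≡ e + b → ∀ x → (a + x) + c ≡ e + (b + x)
  split-in-head {a} {b} {c} e eq x =
    trans (xy∙z≈xz∙y a x c) (trans (cong (_+ x) eq) (+-assoc e b x))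

  split-in-tail : ∀ {a b c} e → a + c ≡ e + b → ∀ x → (x + a) + c ≡ e + (x + b)
  split-in-tail {a} {b} {c} e eq x =
    trans (+-assoc x a c) (trans (cong (x +_) eq) (x∙yz≈y∙xz x e b))

mutual
  size-cutAt+subPiece : ∀ {t} (p : Piece t) (v : Pos p) →
                        size (cutAt p v) + size (subPiece p v) ≡ 1 + size p
  size-cutAt+subPiece {node _} p here = refl
  size-cutAt+subPiece (grow ps) (there i) = cong suc (sizes-cutAtS+subPieceS ps i)

  sizes-cutAtS+subPieceS : ∀ {ts} (ps : Pieces ts) (v : PosS ps) →
                           sizes (cutAtS ps v) + size (subPieceS ps v) ≡ 1 + sizes ps
  sizes-cutAtS+subPieceS (p ∷ ps) (hd i) =
    split-in-head {a = size (cutAt p i)} 1 (size-cutAt+subPiece p i) (sizes ps)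
  sizes-cutAtS+subPieceS (p ∷ ps) (tl i) = split-in-tail 1 (sizes-cutAtS+subPieceS ps i) (size p)

mutual
  portals-cutAt+subPiece : ∀ {t} (p : Piece t) (v : Pos p) →
    portals (cutAt p v) + portals (subPiece p v) ≡ portals (stopAt (subTree p v)) + portals p
  portals-cutAt+subPiece {node _} p here = refl
  portals-cutAt+subPiece (grow ps) (there i) = portalsS-cutAtS+subPieceS ps i

  portalsS-cutAtS+subPieceS : ∀ {ts} (ps : Pieces ts) (v : PosS ps) →
    portalsS (cutAtS ps v) + portals (subPieceS ps v) ≡ portals (stopAt (subTreeS ps v)) + portalsS ps
  portalsS-cutAtS+subPieceS (p ∷ ps) (hd i) =
    split-in-head {a = portals (cutAt p i)} (portals (stopAt (subTree p i))) (portals-cutAt+subPiece p i) (portalsS ps)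
  portalsS-cutAtS+subPieceS (p ∷ ps) (tl i) =
    split-in-tail (portals (stopAt (subTreeS ps i))) (portalsS-cutAtS+subPieceS ps i) (portals p)

portals-cutAt+subPiece≤ : ∀ {t} (p : Piece t) (v : Pos p) →
                          portals (cutAt p v) + portals (subPiece p v) ≤ 1 + portals p
portals-cutAt+subPiece≤ p v = begin
  portals (cutAt p v) + portals (subPiece p v)    ≡⟨ portals-cutAt+subPiece p v ⟩
  portals (stopAt (subTree p v)) + portals p      ≤⟨ +-monoˡ-≤ (portals p) (portals-stopAt≤1 (subTree p v)) ⟩
  1 + portals p                                   ∎
  where open ≤-Reasoning

portals-cutAt≤3 : ∀ {t} (p : Piece t) (v : Pos p) → portals p ≤ 2 → portals (cutAt p v) ≤ 3
portals-cutAt≤3 p v ≤2 = ≤-trans (m≤m+n _ _) (≤-trans (portals-cutAt+subPiece≤ p v) (s≤s ≤2))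

portals-cutAt≤2 : ∀ {t} (p : Piece t) (v : Pos p) → portals p ≤ 3 →
                  portals (subPiece p v) ≡ 2 → portals (cutAt p v) ≤ 2
portals-cutAt≤2 p v ≤3 sub≡2 = +-cancelʳ-≤ 2 _ 2 (begin
  portals (cutAt p v) + 2                       ≡⟨ cong (portals (cutAt p v) +_) sub≡2 ⟨
  portals (cutAt p v) + portals (subPiece p v)  ≤⟨ portals-cutAt+subPiece≤ p v ⟩
  1 + portals p                                 ≤⟨ s≤s ≤3 ⟩
  4                                             ∎)
  where open ≤-Reasoning

mutual
  portals-subPiece≤ : ∀ {t} (p : Piece t) (v : Pos p) → portals (subPiece p v) ≤ portals p
  portals-subPiece≤ p here = ≤-refl
  portals-subPiece≤ (grow ps) (there i) = portalsS-subPieceS≤ ps i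

  portalsS-subPieceS≤ : ∀ {ts} (ps : Pieces ts) (v : PosS ps) → portals (subPieceS ps v) ≤ portalsS ps
  portalsS-subPieceS≤ (p ∷ ps) (hd i) = ≤-trans (portals-subPiece≤ p i) (m≤m+n _ _)
  portalsS-subPieceS≤ (p ∷ ps) (tl i) = ≤-trans (portalsS-subPieceS≤ ps i) (m≤n+m _ _)

size≥1 : ∀ {t} (p : Piece t) → 1 ≤ size p
size≥1 stop     = s≤s z≤n
size≥1 (grow _) = s≤s z≤n

size-grow≥2 : ∀ {t ts} (ps : Pieces (t ∷ ts)) → 2 ≤ size (grow ps)
size-grow≥2 (p ∷ ps) = s≤s (≤-trans (size≥1 p) (m≤m+n _ _))

NonLeafPiece⇒size≥2 : ∀ {t} (p : Piece t) → NonLeafPiece p → 2 ≤ size p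
NonLeafPiece⇒size≥2 (grow ps) _ = size-grow≥2 ps

portals≡2⇒size≥2 : ∀ {t} (p : Piece t) → portals p ≡ 2 → 2 ≤ size p
portals≡2⇒size≥2 (stop {[]})    ()
portals≡2⇒size≥2 (stop {_ ∷ _}) ()
portals≡2⇒size≥2 (grow ps)      _ = size-grow≥2 ps

¬IsRoot⇒size-cutAt≥2 : ∀ {t ts} (ps : Pieces (t ∷ ts)) (v : Pos (grow ps)) →
                       ¬ IsRoot v → 2 ≤ size (cutAt (grow ps) v)
¬IsRoot⇒size-cutAt≥2 ps here      notRoot = ⊥-elim (notRoot tt)
¬IsRoot⇒size-cutAt≥2 ps (there i) _       = size-grow≥2 (cutAtS ps i)

mutual
  size-whole : ∀ t → size (whole t) ≡ treeSize t
  size-whole (node [])       = refl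
  size-whole (node (t ∷ ts)) = cong suc (sizes-wholeS (t ∷ ts))

  sizes-wholeS : ∀ ts → sizes (wholeS ts) ≡ forestSize ts
  sizes-wholeS []       = refl
  sizes-wholeS (t ∷ ts) = cong₂ _+_ (size-whole t) (sizes-wholeS ts)

mutual
  portals-whole : ∀ t → portals (whole t) ≡ 0
  portals-whole (node [])       = refl
  portals-whole (node (t ∷ ts)) = portalsS-wholeS (t ∷ ts)

  portalsS-wholeS : ∀ ts → portalsS (wholeS ts) ≡ 0
  portalsS-wholeS []       = refl
  portalsS-wholeS (t ∷ ts) = cong₂ _+_ (portals-whole t) (portalsS-wholeS ts)

parts<whole : ∀ {n c m} → c + m ≡ suc n → 2 ≤ c → 2 ≤ m → c < n × m < n
parts<whole {n} {c} {m} eq c≥2 m≥2 = below m≥2 (trans (+-comm m c) eq) , below c≥2 eq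
  where
    below : ∀ {a b} → 2 ≤ a → a + b ≡ suc n → b < n
    below {a} {b} a≥2 ab≡ = ≤-pred (begin
      2 + b  ≤⟨ +-monoˡ-≤ b a≥2 ⟩
      a + b  ≡⟨ ab≡ ⟩
      suc n  ∎)
      where open ≤-Reasoning

Balanced⇒3m≤2n+5 : ∀ n {m} → Balanced n m → 3 * m ≤ 2 * n + 5
Balanced⇒3m≤2n+5 n {m} (_ , m≤) = begin
  3 * m                  ≤⟨ *-monoʳ-≤ 3 m≤ ⟩
  3 * ((2 * n + 2) / 3)  ≡⟨ *-comm 3 ((2 * n + 2) / 3) ⟩
  ((2 * n + 2) / 3) * 3  ≤⟨ m/n*n≤m (2 * n + 2) 3 ⟩
  2 * n + 2              ≤⟨ +-monoʳ-≤ (2 * n) (s≤s (s≤s z≤n)) ⟩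
  2 * n + 5              ∎
  where open ≤-Reasoning

Balanced⇒3c≤2n+5 : ∀ n {m c} → Balanced n m → c + m ≡ suc n → 3 * c ≤ 2 * n + 5
Balanced⇒3c≤2n+5 n {m} {c} (n/3≤m , _) eq = +-cancelˡ-≤ n _ _ (begin
  n + 3 * c            ≤⟨ +-monoˡ-≤ (3 * c) n≤3m+2 ⟩
  (3 * m + 2) + 3 * c  ≡⟨ solve 2 (λ m c → (con 3 :* m :+ con 2) :+ con 3 :* c
                                           := con 3 :* (c :+ m) :+ con 2) refl m c ⟩
  3 * (c + m) + 2      ≡⟨ cong (λ x → 3 * x + 2) eq ⟩
  3 * suc n + 2        ≡⟨ solve 1 (λ n → con 3 :* (con 1 :+ n) :+ con 2
                                         := n :+ (con 2 :* n :+ con 5)) refl n ⟩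
  n + (2 * n + 5)      ∎)
  where
    open ≤-Reasoning
    n≤3m+2 : n ≤ 3 * m + 2
    n≤3m+2 = begin
      n                  ≡⟨ m≡m%n+[m/n]*n n 3 ⟩
      n % 3 + n / 3 * 3  ≤⟨ +-mono-≤ (<⇒≤pred (m%n<n n 3)) (*-monoˡ-≤ 3 n/3≤m) ⟩
      2 + m * 3          ≡⟨ +-comm 2 (m * 3) ⟩
      m * 3 + 2          ≡⟨ cong (_+ 2) (*-comm m 3) ⟩
      3 * m + 2          ∎

-- ⌊log₂ n²⌋ drops when n shrinks by a factor √2, which a balanced split
-- achieves for n ≥ 42; for smaller n the second summand drops instead.
φ : ℕ → ℕ
φ n = ⌊log₂ (n * n) ⌋ + n ⊓ 42

φ-mono-≤ : ∀ {m n} → m ≤ n → φ m ≤ φ n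
φ-mono-≤ m≤n = +-mono-≤ (⌊log₂⌋-mono-≤ (*-mono-≤ m≤n m≤n)) (⊓-monoˡ-≤ 42 m≤n)

2s²≤n² : ∀ s n → 3 * s ≤ 2 * n + 5 → 42 ≤ n → 2 * (s * s) ≤ n * n
2s²≤n² s n 3s≤ 42≤n = *-cancelˡ-≤ 9 (begin
  9 * (2 * (s * s))                ≡⟨ nine-twice s ⟩
  2 * ((3 * s) * (3 * s))          ≤⟨ *-monoʳ-≤ 2 (*-mono-≤ 3s≤ 3s≤) ⟩
  2 * ((2 * n + 5) * (2 * n + 5))  ≡⟨ cong (λ n → 2 * ((2 * n + 5) * (2 * n + 5))) n≡42+k ⟩
  2 * ((2 * (42 + k) + 5) * (2 * (42 + k) + 5))
                                   ≤⟨ m≤m+n _ (34 + 44 * k + k * k) ⟩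
  _                                ≡⟨ gap-identity k ⟩
  9 * ((42 + k) * (42 + k))        ≡⟨ cong (λ n → 9 * (n * n)) n≡42+k ⟨
  9 * (n * n)                      ∎)
  where
    open ≤-Reasoning
    k = n ∸ 42
    n≡42+k : n ≡ 42 + k
    n≡42+k = sym (m+[n∸m]≡n 42≤n)
    nine-twice : ∀ s → 9 * (2 * (s * s)) ≡ 2 * ((3 * s) * (3 * s))
    nine-twice = solve 1 (λ s → con 9 :* (con 2 :* (s :* s)) := con 2 :* ((con 3 :* s) :* (con 3 :* s))) refl
    gap-identity : ∀ k → 2 * ((2 * (42 + k) + 5) * (2 * (42 + k) + 5)) + (34 + 44 * k + k * k)
                         ≡ 9 * ((42 + k) * (42 + k))
    gap-identity = solve 1 (λ k → let n = con 42 :+ k in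
      con 2 :* ((con 2 :* n :+ con 5) :* (con 2 :* n :+ con 5)) :+ (con 34 :+ con 44 :* k :+ k :* k)
        := con 9 :* (n :* n)) refl

φ-shrink : ∀ {s n} → 1 ≤ s → 3 * s ≤ 2 * n + 5 → s < n → φ s < φ n
φ-shrink {s} {n} 1≤s 3s≤ s<n with n ≤? 42
... | yes n≤42 = begin-strict
  ⌊log₂ (s * s) ⌋ + s ⊓ 42  ≡⟨ cong (⌊log₂ (s * s) ⌋ +_) (m≤n⇒m⊓n≡m (≤-trans (<⇒≤ s<n) n≤42)) ⟩
  ⌊log₂ (s * s) ⌋ + s       <⟨ +-mono-≤-< (⌊log₂⌋-mono-≤ (*-mono-≤ (<⇒≤ s<n) (<⇒≤ s<n))) s<n ⟩
  ⌊log₂ (n * n) ⌋ + n       ≡⟨ cong (⌊log₂ (n * n) ⌋ +_) (m≤n⇒m⊓n≡m n≤42) ⟨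
  ⌊log₂ (n * n) ⌋ + n ⊓ 42  ∎
  where open ≤-Reasoning
... | no n≰42 =
  +-mono-≤ (log-shrink s 1≤s 3s≤) (≤-trans (m⊓n≤n s 42) (≤-reflexive (sym (m≥n⇒m⊓n≡n 42≤n))))
  where
    open ≤-Reasoning
    42≤n : 42 ≤ n
    42≤n = <⇒≤ (≰⇒> n≰42)
    log-shrink : ∀ s → 1 ≤ s → 3 * s ≤ 2 * n + 5 → suc ⌊log₂ (s * s) ⌋ ≤ ⌊log₂ (n * n) ⌋
    log-shrink s@(suc _) _ 3s≤ = begin
      suc ⌊log₂ (s * s) ⌋      ≡⟨ ⌊log₂[2*b]⌋≡1+⌊log₂b⌋ (s * s) ⟨
      ⌊log₂ (2 * (s * s)) ⌋    ≤⟨ ⌊log₂⌋-mono-≤ (2s²≤n² s n 3s≤ 42≤n) ⟩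
      ⌊log₂ (n * n) ⌋          ∎

n<2^suc⌊log₂n⌋ : ∀ n → n < 2 ^ suc ⌊log₂ n ⌋
n<2^suc⌊log₂n⌋ n with n <? 2 ^ suc ⌊log₂ n ⌋
... | yes n< = n<
... | no n≮ = ⊥-elim (<⇒≱ (n<1+n ⌊log₂ n ⌋) (begin
  suc ⌊log₂ n ⌋                  ≡⟨ ⌊log₂[2^n]⌋≡n (suc ⌊log₂ n ⌋) ⟨
  ⌊log₂ (2 ^ suc ⌊log₂ n ⌋) ⌋    ≤⟨ ⌊log₂⌋-mono-≤ (≮⇒≥ n≮) ⟩
  ⌊log₂ n ⌋                      ∎))
  where open ≤-Reasoning

φ≤2L+42 : ∀ n → φ n ≤ (suc ⌊log₂ n ⌋ + suc ⌊log₂ n ⌋) + 42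
φ≤2L+42 n = +-mono-≤ (begin
  ⌊log₂ (n * n) ⌋          ≤⟨ ⌊log₂⌋-mono-≤ (*-mono-≤ n≤2^L n≤2^L) ⟩
  ⌊log₂ (2 ^ L * 2 ^ L) ⌋  ≡⟨ cong ⌊log₂_⌋ (^-distribˡ-+-* 2 L L) ⟨
  ⌊log₂ (2 ^ (L + L)) ⌋    ≡⟨ ⌊log₂[2^n]⌋≡n (L + L) ⟩
  L + L                    ∎) (m⊓n≤n n 42)
  where
    open ≤-Reasoning
    L = suc ⌊log₂ n ⌋
    n≤2^L = <⇒≤ (n<2^suc⌊log₂n⌋ n)

PortalsAtMost3 : ∀ {t} → Piece t → Set
PortalsAtMost3 p = portals p ≤ 3

record Budget {t} (p : Piece t) (d : DTree) : Set where
  field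
    levels≤      : levels d ≤ 3 + 2 * φ (size p)
    levels≤-few  : portals p ≤ 2 → levels d ≤ 2 + 2 * φ (size p)
    allPortals≤3 : AllPieces PortalsAtMost3 d

leafNodes-levels≤1 : ∀ {ts} (ps : Pieces ts) → levelsL (leafNodes ps) ≤ 1
leafNodes-levels≤1 []                  = z≤n
leafNodes-levels≤1 (_∷_ {node _} _ ps) = ⊔-lub ≤-refl (leafNodes-levels≤1 ps)

leafNodes-portals≤3 : ∀ {ts} (ps : Pieces ts) → AllPiecesL PortalsAtMost3 (leafNodes ps)
leafNodes-portals≤3 []                   = tt
leafNodes-portals≤3 (_∷_ {node us} _ ps) =
  (≤-trans (portals-stopAt≤1 (node us)) (s≤s z≤n) , tt) , leafNodes-portals≤3 ps

levels-pair≤ : ∀ {d₁ d₂ B} → levels d₁ ≤ B → levels d₂ ≤ B → levelsL (d₁ ∷ d₂ ∷ []) ≤ B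
levels-pair≤ l₁ l₂ = ⊔-lub l₁ (⊔-lub l₂ z≤n)

3+2a≤1+2b : ∀ {a b} → a < b → 3 + 2 * a ≤ 1 + 2 * b
3+2a≤1+2b {a} {b} a<b = s≤s (begin
  2 + 2 * a  ≡⟨ *-suc 2 a ⟨
  2 * suc a  ≤⟨ *-monoʳ-≤ 2 a<b ⟩
  2 * b      ∎)
  where open ≤-Reasoning

subPiece-portals≡2⇒¬IsRoot : ∀ {t} {p : Piece t} (v : Pos p) → 3 ≤ portals p →
                             portals (subPiece p v) ≡ 2 → ¬ IsRoot v
subPiece-portals≡2⇒¬IsRoot here 3≤ sub≡2 _ = 1+n≰n (≤-trans 3≤ (≤-reflexive sub≡2))
subPiece-portals≡2⇒¬IsRoot (there _) _ _ ()

module _ {t ts} (ps : Pieces (t ∷ ts)) (v : Pos (grow ps)) {d₁ d₂}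
         (B₁ : Budget (cutAt (grow ps) v) d₁) (B₂ : Budget (subPiece (grow ps) v) d₂) where
  private
    p = grow ps
    n = size p
    c = size (cutAt p v)
    m = size (subPiece p v)
    c+m≡1+n : c + m ≡ suc n
    c+m≡1+n = size-cutAt+subPiece p v
    open Budget

  balanced-split-budget : ¬ IsRoot v → NonLeafPiece (subPiece p v) → Balanced n m →
                          portals p ≤ 3 → Budget p (dnode _ p (d₁ ∷ d₂ ∷ []))
  balanced-split-budget notRoot nonLeaf bal ≤3 = record
    { levels≤      = m≤n⇒m≤1+n levels≤2+
    ; levels≤-few  = λ _ → levels≤2+
    ; allPortals≤3 = ≤3 , allPortals≤3 B₁ , allPortals≤3 B₂ , tt
    }
    where
      c≥2 = ¬IsRoot⇒size-cutAt≥2 ps v notRoot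
      m≥2 = NonLeafPiece⇒size≥2 (subPiece p v) nonLeaf
      c<n×m<n = parts<whole c+m≡1+n c≥2 m≥2
      φc<φn = φ-shrink (≤-trans (s≤s z≤n) c≥2) (Balanced⇒3c≤2n+5 n bal c+m≡1+n) (proj₁ c<n×m<n)
      φm<φn = φ-shrink (≤-trans (s≤s z≤n) m≥2) (Balanced⇒3m≤2n+5 n bal) (proj₂ c<n×m<n)
      levels≤2+ = s≤s (levels-pair≤ (≤-trans (levels≤ B₁) (3+2a≤1+2b φc<φn))
                                    (≤-trans (levels≤ B₂) (3+2a≤1+2b φm<φn)))

  portal-split-budget : 3 ≤ portals p → portals (subPiece p v) ≡ 2 → portals (cutAt p v) ≤ 2 →
                        portals p ≤ 3 → Budget p (dnode _ p (d₁ ∷ d₂ ∷ []))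
  portal-split-budget 3≤ sub≡2 cut≤2 ≤3 = record
    { levels≤      = s≤s (levels-pair≤
                       (≤-trans (levels≤-few B₁ cut≤2) (2+2φ-mono (proj₁ c<n×m<n)))
                       (≤-trans (levels≤-few B₂ (≤-reflexive sub≡2)) (2+2φ-mono (proj₂ c<n×m<n))))
    ; levels≤-few  = λ ≤2 → ⊥-elim (<⇒≱ 3≤ ≤2)
    ; allPortals≤3 = ≤3 , allPortals≤3 B₁ , allPortals≤3 B₂ , tt
    }
    where
      c≥2 = ¬IsRoot⇒size-cutAt≥2 ps v (subPiece-portals≡2⇒¬IsRoot v 3≤ sub≡2)
      m≥2 = portals≡2⇒size≥2 (subPiece p v) sub≡2
      c<n×m<n = parts<whole c+m≡1+n c≥2 m≥2
      2+2φ-mono : ∀ {s} → s < n → 2 + 2 * φ s ≤ 2 + 2 * φ n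
      2+2φ-mono s<n = +-monoʳ-≤ 2 (*-monoʳ-≤ 2 (φ-mono-≤ (<⇒≤ s<n)))

budget : ∀ {t} {p : Piece t} {d} → Run p d → portals p ≤ 3 → Budget p d
budget single ≤3 = record { levels≤ = s≤s z≤n ; levels≤-few = λ _ → s≤s z≤n ; allPortals≤3 = ≤3 , tt }
budget (oneLevel ps _) ≤3 = record
  { levels≤      = s≤s (≤-trans (leafNodes-levels≤1 ps) (s≤s z≤n))
  ; levels≤-few  = λ _ → s≤s (≤-trans (leafNodes-levels≤1 ps) (s≤s z≤n))
  ; allPortals≤3 = ≤3 , leafNodes-portals≤3 ps
  }
budget (split ps _ v (inj₁ (≤2 , notRoot , nonLeaf , bal)) r₁ r₂) ≤3 =
  balanced-split-budget ps v (budget r₁ (portals-cutAt≤3 (grow ps) v ≤2))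
                             (budget r₂ (≤-trans (portals-subPiece≤ (grow ps) v) ≤3))
                             notRoot nonLeaf bal ≤3
budget (split ps _ v (inj₂ (3≤ , sub≡2)) r₁ r₂) ≤3 =
  portal-split-budget ps v (budget r₁ (m≤n⇒m≤1+n cut≤2)) (budget r₂ (m≤n⇒m≤1+n (≤-reflexive sub≡2)))
                           3≤ sub≡2 cut≤2 ≤3
  where cut≤2 = portals-cutAt≤2 (grow ps) v ≤3 sub≡2

lemma1 : Σ ℕ λ C → (Δ : ℕ) (T : Tree) → Binary T → treeSize T ≤ Δ →
           (d : DTree) → Run (whole T) d →
           (levels d ≤ C * suc ⌊log₂ Δ ⌋) × AllPieces (λ p → portals p ≤ 3) d
lemma1 = 91 , λ Δ T _ |T|≤Δ d run →
  let B = budget run (≤-trans (≤-reflexive (portals-whole T)) z≤n)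
      ℓ = ⌊log₂ Δ ⌋
      |T|≤Δ′ = ≤-trans (≤-reflexive (size-whole T)) |T|≤Δ
  in (begin
       levels d                                 ≤⟨ Budget.levels≤ B ⟩
       3 + 2 * φ (size (whole T))               ≤⟨ +-monoʳ-≤ 3 (*-monoʳ-≤ 2 (φ-mono-≤ |T|≤Δ′)) ⟩
       3 + 2 * φ Δ                              ≤⟨ +-monoʳ-≤ 3 (*-monoʳ-≤ 2 (φ≤2L+42 Δ)) ⟩
       3 + 2 * ((suc ℓ + suc ℓ) + 42)           ≤⟨ m≤m+n _ (87 * ℓ) ⟩
       3 + 2 * ((suc ℓ + suc ℓ) + 42) + 87 * ℓ  ≡⟨ collect ℓ ⟩
       91 * suc ℓ                               ∎)
     , Budget.allPortals≤3 B
  where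
    open ≤-Reasoning
    collect : ∀ ℓ → 3 + 2 * ((suc ℓ + suc ℓ) + 42) + 87 * ℓ ≡ 91 * suc ℓ
    collect = solve 1 (λ ℓ → con 3 :+ con 2 :* (((con 1 :+ ℓ) :+ (con 1 :+ ℓ)) :+ con 42) :+ con 87 :* ℓ
                             := con 91 :* (con 1 :+ ℓ)) refl
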